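{- There is an absolute constant $c_0>0$ (not depending on $n$) such that for every integer $n\ge 5$ the following holds. There is a red/blue coloring $\phi$ of the 2-element subsets of $U=\{0,1,\ldots,\lfloor 2^{c_0 n}\rfloor-1\}$ such that every $n$-element set $A\subset U$ contains three elements $a_i<a_j<a_k$ satisfying $\phi(a_i,a_j)=\phi(a_j,a_k)\ne\phi(a_i,a_k)$.
   Context: A red/blue coloring of pairs of a set $U$ is a function $\phi:\binom{U}{2}\to\{\text{red},\text{blue}\}$; for $x\neq y$ we write $\phi(x,y)$ for the color of $\{x,y\}$. -}

module Defs where

open import Data.Nat using (ℕ; suc; _^_; _*_; _≤_; _<_)
open import Data.Product using (_×_)
open import Data.Fin using (Fin) renaming (_<_ to _<ᶠ_)
open import Data.Fin.Subset using (Subset; _∈_; ∣_∣)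
open import Relation.Binary.PropositionalEquality using (_≡_; _≢_)
open import Data.Product using (Σ; ∃; ∃-syntax)

data Color : Set where
  red blue : Color

-- A red/blue coloring of the 2-element subsets of Fin N:
-- a symmetric function on pairs (only used for x ≢ y).
record Coloring (N : ℕ) : Set where
  field
    col : Fin N → Fin N → Color
    sym : ∀ x y → col x y ≡ col y x
open Coloring public

-- N = ⌊ 2^((p/q)·n) ⌋  (for q ≥ 1): N^q ≤ 2^(p·n) < (N+1)^q
IsFloorPow2 : ℕ → ℕ → ℕ → ℕ → Set
IsFloorPow2 p q n N = (N ^ q ≤ 2 ^ (p * n)) × (2 ^ (p * n) < suc N ^ q)

Good : ∀ {N} → ℕ → Coloring N → Set
Good {N} n φ = (A : Subset N) → ∣ A ∣ ≡ n →
  ∃[ i ] ∃[ j ] ∃[ k ]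
    (i ∈ A × j ∈ A × k ∈ A × i <ᶠ j × j <ᶠ k ×
     col φ i j ≡ col φ j k × col φ i j ≢ col φ i k)

-- Colour the pairs at random. If an n-set A has no triple a < b < c with φ(a,b) = φ(b,c) ≠ φ(a,c),
-- then reading red on a pair u < v as "u before v" orders A transitively, so φ on A is determined by
-- the ranks of its elements: φ(u,v) is red iff rank u < rank v. Each of the at most (N·N)^n choices of
-- A and ranks fixes n(n-1)/2 colours, so the union bound succeeds once (N·N)^n < 2^(n(n-1)/2), which
-- N^8 ≤ 2^n ensures. The random colouring is derandomised bit by bit by conditional expectations.
module Submission where

open import Defs hiding (sym)
open import Data.Nat using (ℕ; _≤_; _<_)
open import Data.Product using (Σ; ∃; ∃-syntax; _×_)

open import Data.Nat
  using (zero; suc; _+_; _*_; _^_; _<?_; z≤n; s≤s; z<s; s<s)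
open import Data.Nat.Properties
open import Data.Nat.Tactic.RingSolver using (solve-∀)
open import Algebra.Properties.CommutativeSemigroup +-commutativeSemigroup using (interchange)
open import Data.Bool using (Bool; true; false; not)
open import Data.Bool.Properties using (not-involutive; not-injective; not-¬; ¬-not)
  renaming (_≟_ to _≟ᵇ_)
open import Data.Fin using (Fin; zero; suc) renaming (_<_ to _<ᶠ_)
open import Data.Fin.Properties using (any?)
  renaming (<-cmp to <ᶠ-cmp; <-irrefl to <ᶠ-irrefl; <-trans to <ᶠ-trans; _<?_ to _<ᶠ?_; _≟_ to _≟ᶠ_)
open import Data.Fin.Subset using (Subset; _∈_; _∉_; _⊆_; _∩_; ∣_∣)
open import Data.Fin.Subset.Properties using (_∈?_; p⊂q⇒∣p∣<∣q∣; x∈p∩q⁺; x∈p∩q⁻; ∈⊤; ⊆⊤; ∣⊤∣≡n)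
open import Data.List using (List; []; _∷_; [_]; _++_; map; concatMap; length; upTo; cartesianProductWith)
open import Data.List.Properties using (length-++; length-map; length-upTo; map-++)
open import Data.Nat.ListAction using (sum)
open import Data.Nat.ListAction.Properties using (sum-++)
open import Data.List.Membership.Propositional using () renaming (_∈_ to _∈ˡ_)
open import Data.List.Membership.Propositional.Properties
  using (∈-map⁺; ∈-++⁺ˡ; ∈-++⁺ʳ; ∈-upTo⁺; ∈-cartesianProductWith⁺)
open import Data.List.Relation.Unary.All using (All; []; _∷_)
import Data.List.Relation.Unary.All as All
import Data.List.Relation.Unary.All.Properties as All
open import Data.List.Relation.Unary.Any using (here)
open import Data.Maybe using (Maybe; just; nothing)
import Data.Maybe as Maybe
import Data.Maybe.Relation.Unary.All as Maybeᴬ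
open import Data.Product using (_,_; proj₂)
open import Data.Vec using (Vec; []; _∷_; here; there; lookup; replicate; take; drop; tabulate)
import Data.Vec as Vec
open import Data.Vec.Properties using (take++drop≡id; lookup∘tabulate; []=⇒lookup; lookup⇒[]=)
open import Data.Vec.Relation.Binary.Pointwise.Inductive using (Pointwise; []; _∷_; ++⁺)
open import Function using (_∘_; case_of_)
open import Relation.Binary using (Tri; tri<; tri≈; tri>)
open import Relation.Binary.PropositionalEquality hiding ([_])
open import Relation.Nullary using (¬_; Dec; yes; no; does; contradiction)
open import Relation.Nullary.Decidable using (dec-true; dec-false; _×-dec_; ¬?)

private
  variable
    X : Set
    m n N k B : ℕ

Pattern : ℕ → Set
Pattern = Vec (Maybe Bool)

_⊨_ : Vec Bool m → Pattern m → Set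
x ⊨ c = Pointwise (λ b → Maybeᴬ.All (b ≡_)) x c

nothings : Vec (Maybe X) m → ℕ
nothings []             = 0
nothings (nothing ∷ xs) = suc (nothings xs)
nothings (just _  ∷ xs) = nothings xs

justs : Vec (Maybe X) m → ℕ
justs []             = 0
justs (nothing ∷ xs) = justs xs
justs (just _  ∷ xs) = suc (justs xs)

nothings-++ : (c : Vec (Maybe X) m) (d : Vec (Maybe X) n) → nothings (c Vec.++ d) ≡ nothings c + nothings d
nothings-++ []            d = refl
nothings-++ (nothing ∷ c) d = cong suc (nothings-++ c d)
nothings-++ (just _  ∷ c) d = nothings-++ c d

nothings-replicate : ∀ m → nothings (replicate {A = Maybe X} m nothing) ≡ m
nothings-replicate zero    = refl
nothings-replicate (suc m) = cong suc (nothings-replicate m)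

nothings-map : ∀ {Y : Set} (f : X → Y) (σ : Vec (Maybe X) m) → nothings (Vec.map (Maybe.map f) σ) ≡ nothings σ
nothings-map f []            = refl
nothings-map f (nothing ∷ σ) = cong suc (nothings-map f σ)
nothings-map f (just _  ∷ σ) = nothings-map f σ

nothings+justs : (σ : Vec (Maybe X) m) → nothings σ + justs σ ≡ m
nothings+justs []            = refl
nothings+justs (nothing ∷ σ) = cong suc (nothings+justs σ)
nothings+justs (just _  ∷ σ) = trans (+-suc _ _) (cong suc (nothings+justs σ))

weight : List (Pattern m) → ℕ
weight cs = sum (map (λ c → 2 ^ nothings c) cs)

weight-++ : (cs ds : List (Pattern m)) → weight (cs ++ ds) ≡ weight cs + weight ds
weight-++ cs ds = trans (cong sum (map-++ _ cs ds)) (sum-++ (map _ cs) _)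

residual : Bool → Pattern (suc m) → List (Pattern m)
residual _     (nothing    ∷ c) = [ c ]
residual true  (just true  ∷ c) = [ c ]
residual false (just false ∷ c) = [ c ]
residual true  (just false ∷ c) = []
residual false (just true  ∷ c) = []

restrict : Bool → List (Pattern (suc m)) → List (Pattern m)
restrict b = concatMap (residual b)

weight-residual : (c : Pattern (suc m)) →
  weight (residual false c) + weight (residual true c) ≡ 2 ^ nothings c
weight-residual (nothing    ∷ c) = double (2 ^ nothings c)
  where
  double : ∀ a → (a + 0) + (a + 0) ≡ 2 * a
  double = solve-∀
weight-residual (just true  ∷ c) = +-identityʳ _
weight-residual (just false ∷ c) = trans (+-identityʳ _) (+-identityʳ _)

weight-restrict : (cs : List (Pattern (suc m))) →
  weight (restrict false cs) + weight (restrict true cs) ≡ weight cs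
weight-restrict []       = refl
weight-restrict (c ∷ cs) = begin
    weight (residual false c ++ restrict false cs) + weight (residual true c ++ restrict true cs)
  ≡⟨ cong₂ _+_ (weight-++ (residual false c) _) (weight-++ (residual true c) _) ⟩
    (r₀ + w₀) + (r₁ + w₁)  ≡⟨ interchange r₀ w₀ r₁ w₁ ⟩
    (r₀ + r₁) + (w₀ + w₁)  ≡⟨ cong₂ _+_ (weight-residual c) (weight-restrict cs) ⟩
    2 ^ nothings c + weight cs
  ∎
  where
  open ≡-Reasoning
  r₀ r₁ w₀ w₁ : ℕ
  r₀ = weight (residual false c)
  r₁ = weight (residual true c)
  w₀ = weight (restrict false cs)
  w₁ = weight (restrict true cs)

Avoids : Vec Bool m → List (Pattern m) → Set
Avoids x = All (λ c → ¬ x ⊨ c)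

avoids-residual : ∀ b (x : Vec Bool m) c → Avoids x (residual b c) → ¬ (b ∷ x) ⊨ c
avoids-residual _     x (nothing    ∷ c) (x⊭c ∷ []) (_ ∷ x⊨c) = x⊭c x⊨c
avoids-residual true  x (just true  ∷ c) (x⊭c ∷ []) (_ ∷ x⊨c) = x⊭c x⊨c
avoids-residual false x (just false ∷ c) (x⊭c ∷ []) (_ ∷ x⊨c) = x⊭c x⊨c
avoids-residual true  x (just false ∷ c) [] (Maybeᴬ.just () ∷ _)
avoids-residual false x (just true  ∷ c) [] (Maybeᴬ.just () ∷ _)

avoids-restrict : ∀ b (x : Vec Bool m) cs → Avoids x (restrict b cs) → Avoids (b ∷ x) cs
avoids-restrict b x []       _ = []
avoids-restrict b x (c ∷ cs) h =
  avoids-residual b x c (All.++⁻ˡ (residual b c) h) ∷ avoids-restrict b x cs (All.++⁻ʳ (residual b c) h)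

-- A pattern with f unconstrained positions is matched by 2 ^ f of the 2 ^ m strings. Fixing the
-- first bit splits the weight between the two halves, and one half keeps weight below 2 ^ (m - 1).
avoid : ∀ m (cs : List (Pattern m)) → weight cs < 2 ^ m → ∃[ x ] Avoids x cs
avoid zero    []        _ = [] , []
avoid zero    ([] ∷ cs) (s≤s ())
avoid (suc m) cs light with weight (restrict false cs) <? 2 ^ m
... | yes light₀ = let x , h = avoid m _ light₀ in false ∷ x , avoids-restrict false x cs h
... | no heavy₀  = let x , h = avoid m _ light₁ in true ∷ x , avoids-restrict true x cs h
  where
  open ≤-Reasoning
  light₁ : weight (restrict true cs) < 2 ^ m
  light₁ = +-cancelˡ-< (2 ^ m) _ _ (begin-strict
      2 ^ m + weight (restrict true cs)                      ≤⟨ +-monoˡ-≤ _ (≮⇒≥ heavy₀) ⟩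
      weight (restrict false cs) + weight (restrict true cs) ≡⟨ weight-restrict cs ⟩
      weight cs                                              <⟨ light ⟩
      2 ^ m + (2 ^ m + 0)                                    ≡⟨ cong (2 ^ m +_) (+-identityʳ _) ⟩
      2 ^ m + 2 ^ m                                          ∎)

tri : ℕ → ℕ
tri zero    = 0
tri (suc N) = N + tri N

-- x lists the colours of the N pairs {0, v + 1}, then recursively those of the pairs inside {1, …, N}.
-- The diagonal value is junk: colourings are only consulted at distinct points.
edge : Vec Bool (tri N) → Fin N → Fin N → Bool
edge {suc N} x zero    zero    = false
edge {suc N} x zero    (suc v) = lookup (take N x) v
edge {suc N} x (suc u) zero    = lookup (take N x) u
edge {suc N} x (suc u) (suc v) = edge (drop N x) u v

edge-sym : (x : Vec Bool (tri N)) (u v : Fin N) → edge x u v ≡ edge x v u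
edge-sym {suc N} x zero    zero    = refl
edge-sym {suc N} x zero    (suc v) = refl
edge-sym {suc N} x (suc u) zero    = refl
edge-sym {suc N} x (suc u) (suc v) = edge-sym (drop N x) u v

toColor : Bool → Color
toColor true  = red
toColor false = blue

toColor-injective : ∀ {a b} → toColor a ≡ toColor b → a ≡ b
toColor-injective {true}  {true}  _ = refl
toColor-injective {false} {false} _ = refl

_≟ᶜ_ : (a b : Color) → Dec (a ≡ b)
red  ≟ᶜ red  = yes refl
blue ≟ᶜ blue = yes refl
red  ≟ᶜ blue = no λ ()
blue ≟ᶜ red  = no λ ()

coloring : Vec Bool (tri N) → Coloring N
coloring x = record { col = λ u v → toColor (edge x u v) ; sym = λ u v → cong toColor (edge-sym x u v) }

firstRow : Maybe ℕ → Vec (Maybe ℕ) N → Pattern N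
firstRow nothing  σ = replicate _ nothing
firstRow (just a) σ = Vec.map (Maybe.map (λ b → does (a <? b))) σ

orderPattern : Vec (Maybe ℕ) N → Pattern (tri N)
orderPattern []      = []
orderPattern (s ∷ σ) = firstRow s σ Vec.++ orderPattern σ

OrderedBy : (Fin N → Fin N → Bool) → Vec (Maybe ℕ) N → Set
OrderedBy G σ = ∀ {u v a b} → u <ᶠ v → lookup σ u ≡ just a → lookup σ v ≡ just b → G u v ≡ does (a <? b)

⊨-unconstrained : (x : Vec Bool m) → x ⊨ replicate m nothing
⊨-unconstrained []      = []
⊨-unconstrained (b ∷ x) = Maybeᴬ.nothing ∷ ⊨-unconstrained x

⊨-map : (f : X → Bool) (x : Vec Bool m) (σ : Vec (Maybe X) m) →
  (∀ {i a} → lookup σ i ≡ just a → lookup x i ≡ f a) → x ⊨ Vec.map (Maybe.map f) σ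
⊨-map f []      []             _ = []
⊨-map f (b ∷ x) (nothing ∷ σ) h = Maybeᴬ.nothing ∷ ⊨-map f x σ (λ {i} → h {suc i})
⊨-map f (b ∷ x) (just a  ∷ σ) h = Maybeᴬ.just (h {zero} refl) ∷ ⊨-map f x σ (λ {i} → h {suc i})

⊨-firstRow : (y : Vec Bool N) (s : Maybe ℕ) (σ : Vec (Maybe ℕ) N) →
  (∀ {v a b} → s ≡ just a → lookup σ v ≡ just b → lookup y v ≡ does (a <? b)) → y ⊨ firstRow s σ
⊨-firstRow y nothing  σ _ = ⊨-unconstrained y
⊨-firstRow y (just a) σ h = ⊨-map _ y σ (h refl)

⊨-orderPattern : (x : Vec Bool (tri N)) (σ : Vec (Maybe ℕ) N) → OrderedBy (edge x) σ → x ⊨ orderPattern σ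
⊨-orderPattern {zero}  []  []      _       = []
⊨-orderPattern {suc N} x   (s ∷ σ) ordered = subst (_⊨ orderPattern (s ∷ σ)) (take++drop≡id N x)
  (++⁺ (⊨-firstRow (take N x) s σ (ordered z<s))
       (⊨-orderPattern (drop N x) σ (ordered ∘ s<s)))

nothings-orderPattern : (σ : Vec (Maybe ℕ) N) → nothings (orderPattern σ) + tri (justs σ) ≡ tri N
nothings-orderPattern         []            = refl
nothings-orderPattern {suc N} (nothing ∷ σ) = begin
    nothings (replicate N nothing Vec.++ orderPattern σ) + tri (justs σ)
  ≡⟨ cong (_+ tri (justs σ)) (nothings-++ (replicate N nothing) (orderPattern σ)) ⟩
    (nothings (replicate N nothing) + nothings (orderPattern σ)) + tri (justs σ)
  ≡⟨ cong (λ r → (r + nothings (orderPattern σ)) + tri (justs σ)) (nothings-replicate N) ⟩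
    (N + nothings (orderPattern σ)) + tri (justs σ)
  ≡⟨ +-assoc N _ _ ⟩
    N + (nothings (orderPattern σ) + tri (justs σ))
  ≡⟨ cong (N +_) (nothings-orderPattern σ) ⟩
    N + tri N
  ∎
  where open ≡-Reasoning
nothings-orderPattern {suc N} (just a ∷ σ)  = begin
    nothings (row Vec.++ orderPattern σ) + (justs σ + tri (justs σ))
  ≡⟨ cong (_+ (justs σ + tri (justs σ))) (nothings-++ row (orderPattern σ)) ⟩
    (nothings row + nothings (orderPattern σ)) + (justs σ + tri (justs σ))
  ≡⟨ interchange (nothings row) _ (justs σ) _ ⟩
    (nothings row + justs σ) + (nothings (orderPattern σ) + tri (justs σ))
  ≡⟨ cong₂ _+_ (trans (cong (_+ justs σ) (nothings-map _ σ)) (nothings+justs σ)) (nothings-orderPattern σ) ⟩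
    N + tri N
  ∎
  where
  open ≡-Reasoning
  row : Pattern N
  row = firstRow (just a) σ

rankings : (N k B : ℕ) → List (Vec (Maybe ℕ) N)
rankings zero    zero    B = [ [] ]
rankings zero    (suc k) B = []
rankings (suc N) zero    B = map (nothing ∷_) (rankings N zero B)
rankings (suc N) (suc k) B =
  map (nothing ∷_) (rankings N (suc k) B) ++ cartesianProductWith (λ a σ → just a ∷ σ) (upTo B) (rankings N k B)

Bounded : ℕ → Vec (Maybe ℕ) N → Set
Bounded B σ = ∀ {i a} → lookup σ i ≡ just a → a < B

∈-rankings : (σ : Vec (Maybe ℕ) N) → justs σ ≡ k → Bounded B σ → σ ∈ˡ rankings N k B
∈-rankings               []            refl _       = here refl
∈-rankings {k = zero}    (nothing ∷ σ) eq   bounded = ∈-map⁺ (nothing ∷_) (∈-rankings σ eq (λ {i} → bounded {suc i}))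
∈-rankings {k = suc k}   (nothing ∷ σ) eq   bounded =
  ∈-++⁺ˡ (∈-map⁺ (nothing ∷_) (∈-rankings σ eq (λ {i} → bounded {suc i})))
∈-rankings               (just a ∷ σ)  refl bounded = ∈-++⁺ʳ _ (∈-cartesianProductWith⁺ _
  (∈-upTo⁺ (bounded {zero} refl)) (∈-rankings σ refl (λ {i} → bounded {suc i})))

justs-rankings : ∀ N k B → All (λ σ → justs σ ≡ k) (rankings N k B)
justs-rankings zero    zero    B = refl ∷ []
justs-rankings zero    (suc k) B = []
justs-rankings (suc N) zero    B = All.map⁺ (justs-rankings N zero B)
justs-rankings (suc N) (suc k) B = All.++⁺ (All.map⁺ (justs-rankings N (suc k) B))
  (All.cartesianProductWith⁺ (setoid ℕ) (setoid _) _ (upTo B) (rankings N k B)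
    (λ _ σ∈ → cong suc (All.lookup (justs-rankings N k B) σ∈)))

length-cartesianProductWith : ∀ {X Y Z : Set} (f : X → Y → Z) xs ys →
  length (cartesianProductWith f xs ys) ≡ length xs * length ys
length-cartesianProductWith f []       ys = refl
length-cartesianProductWith f (x ∷ xs) ys =
  trans (length-++ (map (f x) ys)) (cong₂ _+_ (length-map (f x) ys) (length-cartesianProductWith f xs ys))

length-rankings : ∀ N k B → length (rankings N k B) ≤ (N * B) ^ k
length-rankings zero    zero    B = ≤-refl
length-rankings zero    (suc k) B = z≤n
length-rankings (suc N) zero    B = ≤-trans (≤-reflexive (length-map _ (rankings N zero B))) (length-rankings N zero B)
length-rankings (suc N) (suc k) B = begin
    length (map (nothing ∷_) R₁ ++ cartesianProductWith _ (upTo B) R₀)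
  ≡⟨ length-++ (map (nothing ∷_) R₁) ⟩
    length (map (nothing ∷_) R₁) + length (cartesianProductWith _ (upTo B) R₀)
  ≡⟨ cong₂ _+_ (length-map _ R₁)
       (trans (length-cartesianProductWith _ (upTo B) R₀) (cong (_* length R₀) (length-upTo B))) ⟩
    length R₁ + B * length R₀
  ≤⟨ +-mono-≤ (length-rankings N (suc k) B) (*-monoʳ-≤ B (length-rankings N k B)) ⟩
    (N * B) * (N * B) ^ k + B * (N * B) ^ k
  ≡⟨ sym (*-distribʳ-+ _ (N * B) B) ⟩
    (N * B + B) * (N * B) ^ k
  ≡⟨ cong (_* (N * B) ^ k) (+-comm (N * B) B) ⟩
    (suc N * B) * (N * B) ^ k
  ≤⟨ *-monoʳ-≤ (suc N * B) (^-monoˡ-≤ k (*-monoˡ-≤ B (n≤1+n N))) ⟩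
    (suc N * B) ^ suc k
  ∎
  where
  open ≤-Reasoning
  R₀ R₁ : List (Vec (Maybe ℕ) N)
  R₀ = rankings N k B
  R₁ = rankings N (suc k) B

∈-tabulate⁺ : {f : Fin N → Bool} {z : Fin N} → f z ≡ true → z ∈ tabulate f
∈-tabulate⁺ {f = f} {z} fz = lookup⇒[]= z _ (trans (lookup∘tabulate f z) fz)

∈-tabulate⁻ : {f : Fin N → Bool} {z : Fin N} → z ∈ tabulate f → f z ≡ true
∈-tabulate⁻ {f = f} {z} z∈ = trans (sym (lookup∘tabulate f z)) ([]=⇒lookup z∈)

_↾_ : (Fin N → X) → Subset N → Vec (Maybe X) N
f ↾ []          = []
f ↾ (true  ∷ A) = just (f zero) ∷ (f ∘ suc) ↾ A
f ↾ (false ∷ A) = nothing ∷ (f ∘ suc) ↾ A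

justs-↾ : (f : Fin N → X) (A : Subset N) → justs (f ↾ A) ≡ ∣ A ∣
justs-↾ f []          = refl
justs-↾ f (true  ∷ A) = cong suc (justs-↾ (f ∘ suc) A)
justs-↾ f (false ∷ A) = justs-↾ (f ∘ suc) A

lookup-↾ : (f : Fin N → X) (A : Subset N) {i : Fin N} {a : X} → lookup (f ↾ A) i ≡ just a → i ∈ A × f i ≡ a
lookup-↾ f (true  ∷ A) {zero}  refl = here , refl
lookup-↾ f (true  ∷ A) {suc i} eq   = let i∈A , fi≡a = lookup-↾ (f ∘ suc) A eq in there i∈A , fi≡a
lookup-↾ f (false ∷ A) {suc i} eq   = let i∈A , fi≡a = lookup-↾ (f ∘ suc) A eq in there i∈A , fi≡a

TransitiveOn : Subset N → (Fin N → Fin N → Bool) → Set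
TransitiveOn A G =
  ∀ {i j k} → i ∈ A → j ∈ A → k ∈ A → i <ᶠ j → j <ᶠ k → G i j ≡ G j k → G i k ≡ G i j

module Ranking (G : Fin N → Fin N → Bool) (A : Subset N) (transitive : TransitiveOn A G) where

  -- For u < v, G u v = true says that u comes before v.
  _≺_ : Fin N → Fin N → Bool
  x ≺ y with <ᶠ-cmp x y
  ... | tri< _ _ _ = G x y
  ... | tri≈ _ _ _ = false
  ... | tri> _ _ _ = not (G y x)

  ≺-< : ∀ {x y} → x <ᶠ y → x ≺ y ≡ G x y
  ≺-< {x} {y} x<y with <ᶠ-cmp x y
  ... | tri< _    _ _ = refl
  ... | tri≈ x≮y _ _ = contradiction x<y x≮y
  ... | tri> x≮y _ _ = contradiction x<y x≮y

  ≺-> : ∀ {x y} → y <ᶠ x → x ≺ y ≡ not (G y x)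
  ≺-> {x} {y} y<x with <ᶠ-cmp x y
  ... | tri< _ _ y≮x = contradiction y<x y≮x
  ... | tri≈ _ _ y≮x = contradiction y<x y≮x
  ... | tri> _ _ _   = refl

  ≺-irrefl : ∀ x → x ≺ x ≢ true
  ≺-irrefl x with <ᶠ-cmp x x
  ... | tri< x<x _ _ = contradiction x<x (<ᶠ-irrefl refl)
  ... | tri≈ _   _ _ = λ ()
  ... | tri> _ _ x<x = contradiction x<x (<ᶠ-irrefl refl)

  ≺-flip : ∀ {x y} → x ≢ y → y ≺ x ≡ not (x ≺ y)
  ≺-flip {x} {y} x≢y with <ᶠ-cmp x y
  ... | tri< x<y _ _ = ≺-> x<y
  ... | tri≈ _ x≡y _ = contradiction x≡y x≢y
  ... | tri> _ _ y<x = trans (≺-< y<x) (sym (not-involutive _))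

  ≺⇒G : ∀ {x y} → x <ᶠ y → x ≺ y ≡ true → G x y ≡ true
  ≺⇒G x<y x≺y = trans (sym (≺-< x<y)) x≺y

  ≻⇒G : ∀ {x y} → y <ᶠ x → x ≺ y ≡ true → G y x ≡ false
  ≻⇒G y<x x≺y = not-injective (trans (sym (≺-> y<x)) x≺y)

  ¬sorted-cycle : ∀ {i j k} b → i ∈ A → j ∈ A → k ∈ A → i <ᶠ j → j <ᶠ k →
    G i j ≡ b → G j k ≡ b → G i k ≢ not b
  ¬sorted-cycle {i} {j} {k} b iA jA kA i<j j<k ij jk =
    subst (λ c → G i k ≢ not c) ij (not-¬ (transitive iA jA kA i<j j<k (trans ij (sym jk))))

  record Cyclic (x y z : Fin N) : Set where
    constructor cycle
    field
      x≺y : x ≺ y ≡ true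
      y≺z : y ≺ z ≡ true
      z≺x : z ≺ x ≡ true

  cyclic-rotate : ∀ {x y z} → Cyclic x y z → Cyclic y z x
  cyclic-rotate (cycle xy yz zx) = cycle yz zx xy

  ¬cyclic-ascending : ∀ {i j k} → i ∈ A → j ∈ A → k ∈ A → i <ᶠ j → j <ᶠ k → ¬ Cyclic i j k
  ¬cyclic-ascending iA jA kA i<j j<k (cycle ij jk ki) =
    ¬sorted-cycle true iA jA kA i<j j<k (≺⇒G i<j ij) (≺⇒G j<k jk) (≻⇒G (<ᶠ-trans i<j j<k) ki)

  ¬cyclic-descending : ∀ {i j k} → i ∈ A → j ∈ A → k ∈ A → i <ᶠ j → j <ᶠ k → ¬ Cyclic k j i
  ¬cyclic-descending iA jA kA i<j j<k (cycle kj ji ik) =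
    ¬sorted-cycle false iA jA kA i<j j<k (≻⇒G i<j ji) (≻⇒G j<k kj) (≺⇒G (<ᶠ-trans i<j j<k) ik)

  ¬cyclic-from-min : ∀ {x y z} → x ∈ A → y ∈ A → z ∈ A → x <ᶠ y → x <ᶠ z → ¬ Cyclic x y z
  ¬cyclic-from-min {x} {y} {z} xA yA zA x<y x<z c = case <ᶠ-cmp y z of λ where
    (tri< y<z _ _)  → ¬cyclic-ascending xA yA zA x<y y<z c
    (tri≈ _ refl _) → ≺-irrefl y (Cyclic.y≺z c)
    (tri> _ _ z<y)  → ¬cyclic-descending xA zA yA x<z z<y (cyclic-rotate c)

  ¬cyclic : ∀ {x y z} → x ∈ A → y ∈ A → z ∈ A → ¬ Cyclic x y z
  ¬cyclic {x} {y} {z} xA yA zA = by-order (<ᶠ-cmp x y) (<ᶠ-cmp x z) (<ᶠ-cmp y z)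
    where
    by-order : Tri (x <ᶠ y) (x ≡ y) (y <ᶠ x) → Tri (x <ᶠ z) (x ≡ z) (z <ᶠ x) → Tri (y <ᶠ z) (y ≡ z) (z <ᶠ y) →
      ¬ Cyclic x y z
    by-order (tri≈ _ refl _) _ _ c                 = ≺-irrefl x (Cyclic.x≺y c)
    by-order _ (tri≈ _ refl _) _ c                 = ≺-irrefl x (Cyclic.z≺x c)
    by-order _ _ (tri≈ _ refl _) c                 = ≺-irrefl y (Cyclic.y≺z c)
    by-order (tri< x<y _ _) (tri< x<z _ _) _ c     = ¬cyclic-from-min xA yA zA x<y x<z c
    by-order (tri> _ _ y<x) _ (tri< y<z _ _) c     = ¬cyclic-from-min yA zA xA y<z y<x (cyclic-rotate c)
    by-order _ (tri> _ _ z<x) (tri> _ _ z<y) c     =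
      ¬cyclic-from-min zA xA yA z<x z<y (cyclic-rotate (cyclic-rotate c))
    by-order (tri< x<y _ _) (tri> _ _ z<x) (tri< y<z _ _) _ =
      <ᶠ-irrefl refl (<ᶠ-trans (<ᶠ-trans x<y y<z) z<x)
    by-order (tri> _ _ y<x) (tri< x<z _ _) (tri> _ _ z<y) _ =
      <ᶠ-irrefl refl (<ᶠ-trans (<ᶠ-trans y<x x<z) z<y)

  ≺-asym : ∀ {x y} → x ≺ y ≡ true → y ≺ x ≢ true
  ≺-asym {x} {y} xy yx with x ≟ᶠ y
  ... | yes refl = ≺-irrefl x xy
  ... | no x≢y   = not-¬ yx (trans (≺-flip x≢y) (cong not xy))

  ≺-trans : ∀ {x y z} → x ∈ A → y ∈ A → z ∈ A → x ≺ y ≡ true → y ≺ z ≡ true → x ≺ z ≡ true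
  ≺-trans {x} {y} {z} xA yA zA xy yz with x ≟ᶠ z
  ... | yes refl = contradiction yz (≺-asym {x} {y} xy)
  ... | no x≢z   = ¬-not λ xz → ¬cyclic xA yA zA (cycle xy yz (trans (≺-flip x≢z) (cong not xz)))

  predecessors : Fin N → Subset N
  predecessors y = A ∩ tabulate (_≺ y)

  rank : Fin N → ℕ
  rank y = ∣ predecessors y ∣

  ∈-predecessors⁺ : ∀ {y z} → z ∈ A → z ≺ y ≡ true → z ∈ predecessors y
  ∈-predecessors⁺ zA zy = x∈p∩q⁺ (zA , ∈-tabulate⁺ zy)

  ∈-predecessors⁻ : ∀ {y z} → z ∈ predecessors y → z ∈ A × z ≺ y ≡ true
  ∈-predecessors⁻ z∈ = let zA , zy = x∈p∩q⁻ A _ z∈ in zA , ∈-tabulate⁻ zy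

  ∉-predecessors : ∀ y → y ∉ predecessors y
  ∉-predecessors y = ≺-irrefl y ∘ proj₂ ∘ ∈-predecessors⁻

  rank-< : ∀ {x y} → x ∈ A → y ∈ A → x ≺ y ≡ true → rank x < rank y
  rank-< {x} {y} xA yA xy = p⊂q⇒∣p∣<∣q∣ (predecessors-⊆ , x , ∈-predecessors⁺ xA xy , ∉-predecessors x)
    where
    predecessors-⊆ : predecessors x ⊆ predecessors y
    predecessors-⊆ z∈ = let zA , zx = ∈-predecessors⁻ z∈ in ∈-predecessors⁺ zA (≺-trans zA xA yA zx xy)

  rank<N : ∀ y → rank y < N
  rank<N y = subst (rank y <_) (∣⊤∣≡n N) (p⊂q⇒∣p∣<∣q∣ (⊆⊤ , y , ∈⊤ , ∉-predecessors y))

  G-rank : ∀ {u v} → u ∈ A → v ∈ A → u <ᶠ v → G u v ≡ does (rank u <? rank v)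
  G-rank {u} {v} uA vA u<v with G u v in e
  ... | true  = sym (dec-true (rank u <? rank v) (rank-< uA vA (trans (≺-< u<v) e)))
  ... | false = sym (dec-false (rank u <? rank v) (<⇒≯ (rank-< vA uA (trans (≺-> u<v) (cong not e)))))

  ranking-ordered : OrderedBy G (rank ↾ A)
  ranking-ordered u<v σu σv with lookup-↾ rank A σu | lookup-↾ rank A σv
  ... | uA , refl | vA , refl = G-rank uA vA u<v

  ranking-bounded : Bounded N (rank ↾ A)
  ranking-bounded σi with lookup-↾ rank A σi
  ... | _ , refl = rank<N _

transitive⇒matches : (x : Vec Bool (tri N)) (A : Subset N) → TransitiveOn A (edge x) →
  ∃[ σ ] σ ∈ˡ rankings N ∣ A ∣ N × x ⊨ orderPattern σ
transitive⇒matches x A transitive =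
  rank ↾ A , ∈-rankings (rank ↾ A) (justs-↾ rank A) ranking-bounded , ⊨-orderPattern x (rank ↾ A) ranking-ordered
  where open Ranking (edge x) A transitive

BadTriple : Coloring N → Subset N → Set
BadTriple φ A = ∃[ i ] ∃[ j ] ∃[ k ]
  (i ∈ A × j ∈ A × k ∈ A × i <ᶠ j × j <ᶠ k × col φ i j ≡ col φ j k × col φ i j ≢ col φ i k)

badTriple? : (φ : Coloring N) (A : Subset N) → Dec (BadTriple φ A)
badTriple? φ A = any? λ i → any? λ j → any? λ k →
  (i ∈? A) ×-dec (j ∈? A) ×-dec (k ∈? A) ×-dec (i <ᶠ? j) ×-dec (j <ᶠ? k) ×-dec
  (col φ i j ≟ᶜ col φ j k) ×-dec ¬? (col φ i j ≟ᶜ col φ i k)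

¬badTriple⇒transitive : (x : Vec Bool (tri N)) (A : Subset N) →
  ¬ BadTriple (coloring x) A → TransitiveOn A (edge x)
¬badTriple⇒transitive x A ¬bad {i} {j} {k} iA jA kA i<j j<k ij≡jk with edge x i k ≟ᵇ edge x i j
... | yes ik≡ij = ik≡ij
... | no  ik≢ij = contradiction
  (i , j , k , iA , jA , kA , i<j , j<k , cong toColor ij≡jk , ik≢ij ∘ sym ∘ toColor-injective) ¬bad

avoiding⇒good : (x : Vec Bool (tri N)) → Avoids x (map orderPattern (rankings N n N)) → Good n (coloring x)
avoiding⇒good {N} {n} x avoids A |A|≡n with badTriple? (coloring x) A
... | yes bad = bad
... | no ¬bad =
  let σ , σ∈ , x⊨σ = transitive⇒matches x A (¬badTriple⇒transitive x A ¬bad)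
  in contradiction x⊨σ (All.lookup avoids (∈-map⁺ orderPattern (subst (λ k → σ ∈ˡ rankings N k N) |A|≡n σ∈)))

weight-orderPatterns : (σs : List (Vec (Maybe ℕ) N)) → All (λ σ → justs σ ≡ k) σs →
  weight (map orderPattern σs) * 2 ^ tri k ≡ length σs * 2 ^ tri N
weight-orderPatterns     []       []          = refl
weight-orderPatterns {N} (σ ∷ σs) (refl ∷ js) = begin
    (2 ^ nothings (orderPattern σ) + weight (map orderPattern σs)) * 2 ^ tri (justs σ)
  ≡⟨ *-distribʳ-+ (2 ^ tri (justs σ)) (2 ^ nothings (orderPattern σ)) _ ⟩
    2 ^ nothings (orderPattern σ) * 2 ^ tri (justs σ) + weight (map orderPattern σs) * 2 ^ tri (justs σ)
  ≡⟨ cong₂ _+_ pattern-weight (weight-orderPatterns σs js) ⟩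
    2 ^ tri N + length σs * 2 ^ tri N
  ∎
  where
  open ≡-Reasoning
  pattern-weight : 2 ^ nothings (orderPattern σ) * 2 ^ tri (justs σ) ≡ 2 ^ tri N
  pattern-weight =
    trans (sym (^-distribˡ-+-* 2 (nothings (orderPattern σ)) _)) (cong (2 ^_) (nothings-orderPattern σ))

weight-rankingPatterns : ∀ n N → (N * N) ^ n < 2 ^ tri n → weight (map orderPattern (rankings N n N)) < 2 ^ tri N
weight-rankingPatterns n N few = *-cancelʳ-< (2 ^ tri n) _ _ (begin-strict
    weight (map orderPattern (rankings N n N)) * 2 ^ tri n  ≡⟨ weight-orderPatterns _ (justs-rankings N n N) ⟩
    length (rankings N n N) * 2 ^ tri N                   ≤⟨ *-monoˡ-≤ _ (length-rankings N n N) ⟩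
    (N * N) ^ n * 2 ^ tri N                               <⟨ *-monoˡ-< (2 ^ tri N) {{m^n≢0 2 (tri N)}} few ⟩
    2 ^ tri n * 2 ^ tri N                                 ≡⟨ *-comm (2 ^ tri n) _ ⟩
    2 ^ tri N * 2 ^ tri n                                 ∎)
  where open ≤-Reasoning

good-coloring : ∀ n N → (N * N) ^ n < 2 ^ tri n → Σ (Coloring N) (Good n)
good-coloring n N few =
  let x , avoids = avoid (tri N) _ (weight-rankingPatterns n N few) in coloring x , avoiding⇒good x avoids

tri-double : ∀ n → tri n + tri n + n ≡ n * n
tri-double zero    = refl
tri-double (suc n) = begin
    (n + tri n) + (n + tri n) + suc n  ≡⟨ regroup n (tri n) ⟩
    1 + (n + n) + (tri n + tri n + n)  ≡⟨ cong (λ t → 1 + (n + n) + t) (tri-double n) ⟩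
    1 + (n + n) + n * n                ≡⟨ square n ⟩
    suc n * suc n                      ∎
  where
  open ≡-Reasoning
  regroup : ∀ a t → (a + t) + (a + t) + suc a ≡ 1 + (a + a) + (t + t + a)
  regroup = solve-∀
  square : ∀ a → 1 + (a + a) + a * a ≡ suc a * suc a
  square = solve-∀

n≤tri : 3 ≤ n → n ≤ tri n
n≤tri (s≤s (s≤s (s≤s {n = m} z≤n))) =
  s≤s (s≤s (≤-trans (s≤s (m≤m+n m _)) (≤-reflexive (sym (+-suc m _)))))

square<4·tri : 3 ≤ n → n * n < tri n * 4
square<4·tri {n} 3≤n = begin-strict
    n * n                            ≡⟨ sym (tri-double n) ⟩
    tri n + tri n + n                <⟨ +-monoʳ-< (tri n + tri n) (≤-<-trans (n≤tri 3≤n) (m<m+n (tri n) 0<tri)) ⟩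
    tri n + tri n + (tri n + tri n)  ≡⟨ quadruple (tri n) ⟩
    tri n * 4                        ∎
  where
  open ≤-Reasoning
  0<tri : 0 < tri n
  0<tri = <-≤-trans z<s (≤-trans 3≤n (n≤tri 3≤n))
  quadruple : ∀ t → t + t + (t + t) ≡ t * 4
  quadruple = solve-∀

^-cancelʳ-< : ∀ k {a b} → a ^ k < b ^ k → a < b
^-cancelʳ-< k lt = ≰⇒> λ b≤a → <⇒≱ lt (^-monoˡ-≤ k b≤a)

square^n<2^tri : ∀ n N → N ^ 8 ≤ 2 ^ n → 3 ≤ n → (N * N) ^ n < 2 ^ tri n
square^n<2^tri n N N⁸≤2ⁿ 3≤n = ^-cancelʳ-< 4 (begin-strict
    ((N * N) ^ n) ^ 4  ≡⟨ ^-*-assoc (N * N) n 4 ⟩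
    (N * N) ^ (n * 4)  ≡⟨ cong ((N * N) ^_) (*-comm n 4) ⟩
    (N * N) ^ (4 * n)  ≡⟨ sym (^-*-assoc (N * N) 4 n) ⟩
    ((N * N) ^ 4) ^ n  ≡⟨ cong (_^ n) square^4 ⟩
    (N ^ 8) ^ n        ≤⟨ ^-monoˡ-≤ n N⁸≤2ⁿ ⟩
    (2 ^ n) ^ n        ≡⟨ ^-*-assoc 2 n n ⟩
    2 ^ (n * n)        <⟨ ^-monoʳ-< 2 (s≤s (s≤s z≤n)) (square<4·tri 3≤n) ⟩
    2 ^ (tri n * 4)    ≡⟨ sym (^-*-assoc 2 (tri n) 4) ⟩
    (2 ^ tri n) ^ 4    ∎)
  where
  open ≤-Reasoning
  square^4 : (N * N) ^ 4 ≡ N ^ 8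
  square^4 = trans (cong (λ a → (N * a) ^ 4) (sym (*-identityʳ N))) (^-*-assoc N 2 4)

lemma3p1 : ∃[ p ] ∃[ q ] (0 < p × 0 < q ×
    (∀ n → 5 ≤ n → ∀ N → IsFloorPow2 p q n N →
    Σ (Coloring N) (λ φ → Good n φ)))
lemma3p1 = 1 , 8 , s≤s z≤n , s≤s z≤n , λ n 5≤n N (N⁸≤2ⁿ , _) →
  good-coloring n N (square^n<2^tri n N (subst (λ e → N ^ 8 ≤ 2 ^ e) (*-identityˡ n) N⁸≤2ⁿ) (≤-trans 3≤5 5≤n))
  where
  3≤5 : 3 ≤ 5
  3≤5 = s≤s (s≤s (s≤s z≤n))
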